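{- Let $B$ and $r$ be positive integers with $r>\frac{2}{3}B$. Under deferred even splitting subject to batched insertions of $r$ keys, the average fullness obtained (in the limit as the number of batches tends to infinity) is at least \[\max\left\{\frac{2}{3},\ \frac{r/B+\frac12}{\lceil r/B+1\rceil}\right\}-\frac{1}{B}.\]
   Context: Keys are stored in sorted order partitioned into contiguous blocks of at most $B$ keys each. Insertions arrive in batches: each batch consists of $r$ keys that are consecutive in key order and are inserted at a single position, hence into a single block. Deferred even splitting: if a batch of $r$ keys is inserted into a block currently holding $\ell$ keys and $r+\ell\le B$, the block simply grows; if $r+\ell>B$, the block is replaced by $\lceil (r+\ell)/B\rceil$ contiguous blocks whose sizes differ from each other by at most $1$. The fullness of a block is its number of keys divided by $B$, and the average fullness is the mean of this over all blocks. -}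

module Defs where

open import Data.Nat using (ℕ; zero; suc; _+_; _*_; _∸_; _≤?_; _/_; _%_)
open import Data.List using (List; []; _∷_; _++_; replicate; length)
open import Data.Nat.ListAction using (sum)
open import Data.Integer using (+_)
open import Data.Rational using (ℚ; 0ℚ; _⊔_; _-_) renaming (_/_ to _÷_)
open import Relation.Nullary using (yes; no)

-- A configuration is the list (in key order) of block sizes (numbers of keys).

-- ⌈ m / B ⌉  (B = 0 is a junk case, never used since B > 0)
ceilDiv : ℕ → ℕ → ℕ
ceilDiv m zero    = 0
ceilDiv m (suc b) = (m + b) / suc b

evenSplit : ℕ → ℕ → List ℕ
evenSplit m zero    = []
evenSplit m (suc k) =
  replicate (m % suc k) (suc (m / suc k)) ++ replicate (suc k ∸ m % suc k) (m / suc k)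

insertBatch : (B r ℓ : ℕ) → List ℕ
insertBatch B r ℓ with r + ℓ ≤? B
... | yes _ = (r + ℓ) ∷ []
... | no  _ = evenSplit (r + ℓ) (ceilDiv (r + ℓ) B)

-- Replace the i-th block by the list f (its size); an index past the end
-- designates the last block (so every block can be chosen, and every step
-- really inserts a batch).
applyAt : (ℕ → List ℕ) → ℕ → List ℕ → List ℕ
applyAt f i [] = []
applyAt f zero (x ∷ xs) = f x ++ xs
applyAt f (suc i) (x ∷ []) = f x
applyAt f (suc i) (x ∷ y ∷ xs) = x ∷ applyAt f i (y ∷ xs)

run : (B r : ℕ) → (ℕ → ℕ) → ℕ → List ℕ
run B r choice zero    = 0 ∷ []
run B r choice (suc n) = applyAt (insertBatch B r) (choice n) (run B r choice n)

-- Average fullness: mean over blocks of (block size / B) = (total keys)/(B · #blocks).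
avgFullness : ℕ → List ℕ → ℚ
avgFullness zero    s = 0ℚ
avgFullness (suc b) s with length s
... | zero  = 0ℚ
... | suc l = (+ sum s) ÷ (suc b * suc l)

-- max{ 2/3 , (r/B + 1/2) / ⌈r/B + 1⌉ } - 1/B ,  using
-- (r/B + 1/2)/⌈r/B+1⌉ = (2r + B) / (2B (⌈r/B⌉ + 1)).
bound : ℕ → ℕ → ℚ
bound zero    r = 0ℚ
bound (suc b) r =
  ((+ 2) ÷ 3 ⊔ (+ (2 * r + suc b)) ÷ (2 * suc b * suc (ceilDiv r (suc b))))
  - (+ 1) ÷ suc b

module Submission where

-- Call a block of x keys good if (x + 1)/B reaches both 2/3 and (2r + B)/(2B(c + 1)), where
-- c = ⌈r/B⌉, and viable if x ≤ B, 2(x + 1) ≥ B and 3(r + x + 1) > 4B.  Inserting a batch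
-- into a viable block yields only good blocks, good blocks are viable, and the first batch
-- turns the initial empty block into at most c viable blocks.  So at all times every block
-- is viable and at most c blocks fail to be good.  Averaging (x + 1)/B over the blocks, the
-- average fullness is at least each target minus 1/B minus O(c / #blocks), and #blocks
-- grows linearly with the number of batches because no block holds more than B keys.

open import Algebra.Properties.CommutativeSemigroup using (x∙yz≈y∙xz)
import Data.Integer as ℤ
import Data.Integer.Properties as ℤ
open import Data.List using (List; []; _∷_; _++_; [_]; length; replicate; filter)
open import Data.List.Properties
  using (++-identityʳ; length-++; length-replicate; length-filter; filter-++; filter-none)
open import Data.List.Relation.Unary.All as All using (All; []; _∷_)
open import Data.List.Relation.Unary.All.Properties using (++⁺; replicate⁺)
open import Data.Nat
open import Data.Nat.DivMod
open import Data.Nat.ListAction using (sum)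
open import Data.Nat.ListAction.Properties using (sum-++)
open import Data.Nat.Properties
open import Data.Nat.Tactic.RingSolver using (solve-∀)
open import Data.Product using (_×_; _,_; proj₁; proj₂; ∃-syntax)
import Data.Rational as ℚ
import Data.Rational.Properties as ℚ
open import Data.Rational using (ℚ; mkℚ; 0ℚ) renaming (_/_ to _÷_)
open import Data.Rational.Solver using (module +-*-Solver)
import Data.Rational.Unnormalised as ℚᵘ
import Data.Rational.Unnormalised.Properties as ℚᵘ
open import Relation.Binary.PropositionalEquality hiding ([_])
open import Relation.Nullary using (yes; no; contradiction)
open import Relation.Nullary.Decidable using (_×-dec_)
open import Relation.Unary using (Pred; Decidable)
open import Relation.Unary.Properties using (∁?)
open import Defs

k*B<[1+k]*x⇒i*B<[1+j]*x : ∀ i j k B x →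
                          k * B < suc k * x → i * suc k ≤ suc j * k → i * B < suc j * x
k*B<[1+k]*x⇒i*B<[1+j]*x i j k B x kB<Kx ratio =
  *-cancelˡ-< (suc k) (i * B) (suc j * x) (begin-strict
    suc k * (i * B)       ≡⟨ e₁ i k B ⟩
    i * suc k * B         ≤⟨ *-monoˡ-≤ B ratio ⟩
    suc j * k * B         ≡⟨ *-assoc (suc j) k B ⟩
    suc j * (k * B)       <⟨ *-monoʳ-< (suc j) kB<Kx ⟩
    suc j * (suc k * x)   ≡⟨ e₂ j k x ⟩
    suc k * (suc j * x)   ∎)
  where
  open ≤-Reasoning
  e₁ : ∀ i k B → suc k * (i * B) ≡ i * suc k * B
  e₁ = solve-∀
  e₂ : ∀ j k x → suc j * (suc k * x) ≡ suc k * (suc j * x)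
  e₂ = solve-∀

sum-replicate : ∀ n x → sum (replicate n x) ≡ n * x
sum-replicate zero    x = refl
sum-replicate (suc n) x = cong (x +_) (sum-replicate n x)

sum≤length*m : ∀ {m xs} → All (_≤ m) xs → sum xs ≤ length xs * m
sum≤length*m []         = z≤n
sum≤length*m (x≤m ∷ xs) = +-mono-≤ x≤m (sum≤length*m xs)

replicate⁺-nonEmpty : ∀ {a p} {A : Set a} {P : Pred A p} n {x} →
                      (0 < n → P x) → All P (replicate n x)
replicate⁺-nonEmpty zero    _  = []
replicate⁺-nonEmpty (suc n) px = replicate⁺ (suc n) (px z<s)

module _ (m k : ℕ) where

  private
    K q a : ℕ
    K = suc k
    q = m / K
    a = m % K
    a≤K : a ≤ K
    a≤K = m%n≤n m K
    m≡a+qK : m ≡ a + q * K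
    m≡a+qK = m≡m%n+[m/n]*n m K

  length-evenSplit : length (evenSplit m K) ≡ K
  length-evenSplit = begin
    length (replicate a (suc q) ++ replicate (K ∸ a) q)
      ≡⟨ length-++ (replicate a (suc q)) ⟩
    length (replicate a (suc q)) + length (replicate (K ∸ a) q)
      ≡⟨ cong₂ _+_ (length-replicate a) (length-replicate (K ∸ a)) ⟩
    a + (K ∸ a)
      ≡⟨ m+[n∸m]≡n a≤K ⟩
    K ∎
    where open ≡-Reasoning

  sum-evenSplit : sum (evenSplit m K) ≡ m
  sum-evenSplit = begin
    sum (replicate a (suc q) ++ replicate (K ∸ a) q)
      ≡⟨ sum-++ (replicate a (suc q)) _ ⟩
    sum (replicate a (suc q)) + sum (replicate (K ∸ a) q)
      ≡⟨ cong₂ _+_ (sum-replicate a (suc q)) (sum-replicate (K ∸ a) q) ⟩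
    a * suc q + (K ∸ a) * q
      ≡⟨ e a q (K ∸ a) ⟩
    a + (a + (K ∸ a)) * q
      ≡⟨ cong (λ n → a + n * q) (m+[n∸m]≡n a≤K) ⟩
    a + K * q
      ≡⟨ cong (a +_) (*-comm q K) ⟨
    a + q * K
      ≡⟨ m≡a+qK ⟨
    m ∎
    where
    open ≡-Reasoning
    e : ∀ a q n → a * suc q + n * q ≡ a + (a + n) * q
    e = solve-∀

  evenSplit-lower : All (λ x → m < K * suc x) (evenSplit m K)
  evenSplit-lower = ++⁺ (replicate⁺ a (≤-trans m<K[1+q] (*-monoʳ-≤ K (n≤1+n _))))
                        (replicate⁺ (K ∸ a) m<K[1+q])
    where
    open ≤-Reasoning
    m<K[1+q] : m < K * suc q
    m<K[1+q] = begin-strict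
      m           ≡⟨ m≡a+qK ⟩
      a + q * K   <⟨ +-monoˡ-< (q * K) (m%n<n m K) ⟩
      K + q * K   ≡⟨ cong (K +_) (*-comm q K) ⟩
      K + K * q   ≡⟨ *-suc K q ⟨
      K * suc q   ∎

  evenSplit-upper : ∀ {B} → m ≤ K * B → All (_≤ B) (evenSplit m K)
  evenSplit-upper {B} m≤KB = ++⁺ (replicate⁺-nonEmpty a q<B) (replicate⁺ (K ∸ a) q≤B)
    where
    open ≤-Reasoning
    q≤B : q ≤ B
    q≤B = *-cancelˡ-≤ K (begin
      K * q  ≡⟨ *-comm K q ⟩
      q * K  ≤⟨ m/n*n≤m m K ⟩
      m      ≤⟨ m≤KB ⟩
      K * B  ∎)
    q<B : 0 < a → q < B
    q<B 0<a = *-cancelˡ-< K q B (begin-strict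
      K * q      ≡⟨ *-comm K q ⟩
      q * K      <⟨ m<n+m (q * K) 0<a ⟩
      a + q * K  ≡⟨ m≡a+qK ⟨
      m          ≤⟨ m≤KB ⟩
      K * B      ∎)

module _ (m b : ℕ) where

  private
    B : ℕ
    B = suc b

  ceilDiv-lower : m ≤ ceilDiv m B * B
  ceilDiv-lower = +-cancelʳ-≤ b m _ (begin
    m + b                           ≡⟨ m≡m%n+[m/n]*n (m + b) B ⟩
    (m + b) % B + ceilDiv m B * B   ≤⟨ +-monoˡ-≤ _ (m<1+n⇒m≤n (m%n<n (m + b) B)) ⟩
    b + ceilDiv m B * B             ≡⟨ +-comm b _ ⟩
    ceilDiv m B * B + b             ∎)
    where open ≤-Reasoning

  ceilDiv-upper : ceilDiv m B * B ≤ m + b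
  ceilDiv-upper = m/n*n≤m (m + b) B

insertBatch-elim : ∀ {p} (P : List ℕ → Set p) b r ℓ →
                   (r + ℓ ≤ suc b → P [ r + ℓ ]) →
                   (∀ k → suc k * suc b < r + ℓ → r + ℓ ≤ (2 + k) * suc b →
                      P (evenSplit (r + ℓ) (2 + k))) →
                   P (insertBatch (suc b) r ℓ)
insertBatch-elim P b r ℓ unsplit split with r + ℓ ≤? suc b
... | yes m≤B = unsplit m≤B
... | no  m≰B
  with ceilDiv (r + ℓ) (suc b) | ceilDiv-lower (r + ℓ) b | ceilDiv-upper (r + ℓ) b
... | zero        | m≤0  | _      = contradiction (≤-trans m≤0 z≤n) m≰B
... | suc zero    | m≤1*B | _     = contradiction (≤-trans m≤1*B (≤-reflexive (*-identityˡ (suc b)))) m≰B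
... | suc (suc k) | m≤KB | KB≤m+b = split k kB<m m≤KB
  where
  open ≤-Reasoning
  kB<m : suc k * suc b < r + ℓ
  kB<m = +-cancelˡ-< b _ _ (begin-strict
    b + suc k * suc b  <⟨ n<1+n _ ⟩
    (2 + k) * suc b    ≤⟨ KB≤m+b ⟩
    r + ℓ + b          ≡⟨ +-comm (r + ℓ) b ⟩
    b + (r + ℓ)        ∎)

module _ (b r ℓ : ℕ) where

  sum-insertBatch : sum (insertBatch (suc b) r ℓ) ≡ r + ℓ
  sum-insertBatch = insertBatch-elim (λ xs → sum xs ≡ r + ℓ) b r ℓ
    (λ _ → +-identityʳ (r + ℓ)) (λ k _ _ → sum-evenSplit (r + ℓ) (suc k))

  insertBatch-≤ : All (_≤ suc b) (insertBatch (suc b) r ℓ)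
  insertBatch-≤ = insertBatch-elim (All (_≤ suc b)) b r ℓ
    (λ m≤B → m≤B ∷ []) (λ k _ m≤KB → evenSplit-upper (r + ℓ) (suc k) m≤KB)

  insertBatch-nonEmpty : 0 < length (insertBatch (suc b) r ℓ)
  insertBatch-nonEmpty = insertBatch-elim (λ xs → 0 < length xs) b r ℓ
    (λ _ → z<s) (λ k _ _ → subst (0 <_) (sym (length-evenSplit (r + ℓ) (suc k))) z<s)

module _ {a p} {A : Set a} {P : Pred A p} (P? : Decidable P) where

  failures : List A → ℕ
  failures xs = length (filter (∁? P?) xs)

  failures-++ : ∀ xs ys → failures (xs ++ ys) ≡ failures xs + failures ys
  failures-++ xs ys =
    trans (cong length (filter-++ (∁? P?) xs ys)) (length-++ (filter (∁? P?) xs))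

  failures-none : ∀ {xs} → All P xs → failures xs ≡ 0
  failures-none ps = cong length (filter-none (∁? P?) (All.map (λ px ¬px → ¬px px) ps))

  failures-∷ : ∀ x xs → failures xs ≤ failures (x ∷ xs)
  failures-∷ x xs with P? x
  ... | yes _ = ≤-refl
  ... | no  _ = n≤1+n _

  failures-∷-mono : ∀ x {xs ys} → failures xs ≤ failures ys →
                    failures (x ∷ xs) ≤ failures (x ∷ ys)
  failures-∷-mono x le with P? x
  ... | yes _ = le
  ... | no  _ = s≤s le

  failures≤length : ∀ xs → failures xs ≤ length xs
  failures≤length = length-filter (∁? P?)

module _ {p} {P : Pred ℕ p} (P? : Decidable P) (α β : ℕ)
         (α≤β[1+x] : ∀ {x} → P x → α ≤ β * suc x) where

  length≤sum+failures : ∀ xs → α * length xs ≤ β * (sum xs + length xs) + α * failures P? xs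
  length≤sum+failures [] = ≤-trans (≤-reflexive (*-zeroʳ α)) z≤n
  length≤sum+failures (x ∷ xs) with P? x
  ... | yes px = begin
    α * suc L                         ≡⟨ *-suc α L ⟩
    α + α * L                         ≤⟨ +-mono-≤ (α≤β[1+x] px) (length≤sum+failures xs) ⟩
    β * suc x + (β * (S + L) + α * N) ≡⟨ e α β x S L N ⟩
    β * (x + S + suc L) + α * N       ∎
    where
    open ≤-Reasoning
    L S N : ℕ
    L = length xs
    S = sum xs
    N = failures P? xs
    e : ∀ α β x S L N → β * suc x + (β * (S + L) + α * N) ≡ β * (x + S + suc L) + α * N
    e = solve-∀
  ... | no _ = begin
    α * suc L                         ≡⟨ *-suc α L ⟩
    α + α * L                         ≤⟨ +-monoʳ-≤ α (length≤sum+failures xs) ⟩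
    α + (β * (S + L) + α * N)         ≡⟨ e α β S L N ⟩
    β * (S + L) + α * suc N           ≤⟨ +-monoˡ-≤ (α * suc N) (*-monoʳ-≤ β S+L≤) ⟩
    β * (x + S + suc L) + α * suc N   ∎
    where
    open ≤-Reasoning
    L S N : ℕ
    L = length xs
    S = sum xs
    N = failures P? xs
    S+L≤ : S + L ≤ x + S + suc L
    S+L≤ = +-mono-≤ (m≤n+m S x) (n≤1+n L)
    e : ∀ α β S L N → α + (β * (S + L) + α * N) ≡ β * (S + L) + α * suc N
    e = solve-∀

module _ (f : ℕ → List ℕ) where

  applyAt-singleton : ∀ i x → applyAt f i (x ∷ []) ≡ f x
  applyAt-singleton zero    x = ++-identityʳ (f x)
  applyAt-singleton (suc i) x = refl

  applyAt-All : ∀ {p} {P : Pred ℕ p} → (∀ {x} → P x → All P (f x)) →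
                ∀ i xs → All P xs → All P (applyAt f i xs)
  applyAt-All step i       []           []          = []
  applyAt-All step zero    (x ∷ xs)     (px ∷ pxs)  = ++⁺ (step px) pxs
  applyAt-All step (suc i) (x ∷ [])     (px ∷ [])   = step px
  applyAt-All step (suc i) (x ∷ y ∷ xs) (px ∷ pys)  = px ∷ applyAt-All step i (y ∷ xs) pys

  applyAt-failures : ∀ {p q} {P : Pred ℕ p} {Q : Pred ℕ q} (P? : Decidable P) →
                     (∀ {x} → Q x → All P (f x)) →
                     ∀ i xs → All Q xs → failures P? (applyAt f i xs) ≤ failures P? xs
  applyAt-failures P? step i       []           []         = z≤n
  applyAt-failures P? step zero    (x ∷ xs)     (qx ∷ _)   = begin
    failures P? (f x ++ xs)              ≡⟨ failures-++ P? (f x) xs ⟩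
    failures P? (f x) + failures P? xs   ≡⟨ cong (_+ _) (failures-none P? (step qx)) ⟩
    failures P? xs                       ≤⟨ failures-∷ P? x xs ⟩
    failures P? (x ∷ xs)                 ∎
    where open ≤-Reasoning
  applyAt-failures P? step (suc i) (x ∷ [])     (qx ∷ [])  =
    ≤-trans (≤-reflexive (failures-none P? (step qx))) z≤n
  applyAt-failures P? step (suc i) (x ∷ y ∷ xs) (_ ∷ qys)  =
    failures-∷-mono P? x (applyAt-failures P? step i (y ∷ xs) qys)

  applyAt-nonEmpty : (∀ x → 0 < length (f x)) →
                     ∀ i xs → 0 < length xs → 0 < length (applyAt f i xs)
  applyAt-nonEmpty nonEmpty zero    (x ∷ xs)     _ =
    ≤-trans (nonEmpty x) (≤-trans (m≤m+n _ _) (≤-reflexive (sym (length-++ (f x)))))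
  applyAt-nonEmpty nonEmpty (suc i) (x ∷ [])     _ = nonEmpty x
  applyAt-nonEmpty nonEmpty (suc i) (x ∷ y ∷ xs) _ = z<s

  applyAt-sum : ∀ {r} → (∀ x → sum (f x) ≡ r + x) →
                ∀ i xs → 0 < length xs → sum (applyAt f i xs) ≡ r + sum xs
  applyAt-sum {r} sum-f zero (x ∷ xs) _ = begin
    sum (f x ++ xs)     ≡⟨ sum-++ (f x) xs ⟩
    sum (f x) + sum xs  ≡⟨ cong (_+ sum xs) (sum-f x) ⟩
    r + x + sum xs      ≡⟨ +-assoc r x (sum xs) ⟩
    r + (x + sum xs)    ∎
    where open ≡-Reasoning
  applyAt-sum {r} sum-f (suc i) (x ∷ [])     _ = trans (sum-f x) (cong (r +_) (sym (+-identityʳ x)))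
  applyAt-sum {r} sum-f (suc i) (x ∷ y ∷ xs) _ =
    trans (cong (x +_) (applyAt-sum sum-f i (y ∷ xs) z<s))
          (x∙yz≈y∙xz +-commutativeSemigroup x r (sum (y ∷ xs)))

toℚᵘ-÷ : ∀ m a .{{_ : NonZero a}} → ℚ.toℚᵘ ((ℤ.+ m) ÷ a) ℚᵘ.≃ (ℤ.+ m) ℚᵘ./ a
toℚᵘ-÷ m (suc a) = ℚ.toℚᵘ-fromℚᵘ (ℚᵘ.mkℚᵘ (ℤ.+ m) a)

fraction-≤ : ∀ m a n b .{{_ : NonZero a}} .{{_ : NonZero b}} →
             m * b ≤ n * a → (ℤ.+ m) ÷ a ℚ.≤ (ℤ.+ n) ÷ b
fraction-≤ m a@(suc _) n b@(suc _) le =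
  ℚ.toℚᵘ-cancel-≤ (ℚᵘ.≤-respˡ-≃ (ℚᵘ.≃-sym (toℚᵘ-÷ m a)) (ℚᵘ.≤-respʳ-≃ (ℚᵘ.≃-sym (toℚᵘ-÷ n b))
    (ℚᵘ.*≤* (subst₂ ℤ._≤_ (ℤ.pos-* m b) (ℤ.pos-* n a) (ℤ.+≤+ le)))))

fraction-+ : ∀ m n a b .{{_ : NonZero a}} .{{_ : NonZero b}} →
             (ℤ.+ m) ÷ a ℚ.+ (ℤ.+ n) ÷ b ≡ ((ℤ.+ (m * b + n * a)) ÷ (a * b)) {{m*n≢0 a b}}
fraction-+ m n a@(suc _) b@(suc _) = ℚ.toℚᵘ-injective (begin
  ℚ.toℚᵘ ((ℤ.+ m) ÷ a ℚ.+ (ℤ.+ n) ÷ b)            ≈⟨ ℚ.toℚᵘ-homo-+ ((ℤ.+ m) ÷ a) ((ℤ.+ n) ÷ b) ⟩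
  ℚ.toℚᵘ ((ℤ.+ m) ÷ a) ℚᵘ.+ ℚ.toℚᵘ ((ℤ.+ n) ÷ b)  ≈⟨ ℚᵘ.+-cong (toℚᵘ-÷ m a) (toℚᵘ-÷ n b) ⟩
  (ℤ.+ m) ℚᵘ./ a ℚᵘ.+ (ℤ.+ n) ℚᵘ./ b              ≡⟨ cong (ℚᵘ._/ (a * b)) numerator ⟩
  (ℤ.+ (m * b + n * a)) ℚᵘ./ (a * b)              ≈⟨ toℚᵘ-÷ (m * b + n * a) (a * b) ⟨
  ℚ.toℚᵘ ((ℤ.+ (m * b + n * a)) ÷ (a * b))        ∎)
  where
  open ℚᵘ.≃-Reasoning
  numerator : ℤ.+ m ℤ.* ℤ.+ b ℤ.+ ℤ.+ n ℤ.* ℤ.+ a ≡ ℤ.+ (m * b + n * a)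
  numerator = sym (trans (ℤ.pos-+ (m * b) (n * a)) (cong₂ ℤ._+_ (ℤ.pos-* m b) (ℤ.pos-* n a)))

p≤q+r+s⇒p-r-s≤q : ∀ {p q r s} → p ℚ.≤ q ℚ.+ r ℚ.+ s → p ℚ.- r ℚ.- s ℚ.≤ q
p≤q+r+s⇒p-r-s≤q {p} {q} {r} {s} le =
  ℚ.≤-trans (ℚ.+-monoˡ-≤ (ℚ.- s) (ℚ.+-monoˡ-≤ (ℚ.- r) le)) (ℚ.≤-reflexive (cancel q r s))
  where
  open +-*-Solver
  cancel : ∀ q r s → q ℚ.+ r ℚ.+ s ℚ.- r ℚ.- s ≡ q
  cancel = solve 3 (λ q r s → q :+ r :+ s :- r :- s := q) refl

0<ε⇒∃1/[1+d]≤ε : ∀ ε → 0ℚ ℚ.< ε → ∃[ d ] (ℤ.+ 1) ÷ suc d ℚ.≤ ε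
0<ε⇒∃1/[1+d]≤ε ε@(mkℚ (ℤ.+ suc k) d _) _ =
  d , subst ((ℤ.+ 1) ÷ suc d ℚ.≤_) (ℚ.↥p/↧p≡p ε)
            (fraction-≤ 1 (suc d) (suc k) (suc d) (*-monoˡ-≤ (suc d) {1} {suc k} (s≤s z≤n)))
0<ε⇒∃1/[1+d]≤ε (mkℚ (ℤ.+ zero) _ _)  (ℚ.*<* (ℤ.+<+ ()))
0<ε⇒∃1/[1+d]≤ε (mkℚ ℤ.-[1+ _ ] _ _) (ℚ.*<* ())

-- The first hypothesis is what length≤sum+failures gives for L blocks holding S keys when
-- all but N of them have (x + 1)/B ≥ a/q.
fraction≤mean+1/B+1/D : ∀ a q B L D S N →
  .{{_ : NonZero q}} .{{_ : NonZero B}} .{{_ : NonZero L}} .{{_ : NonZero D}} →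
  a * B * L ≤ q * (S + L) + a * B * N → a * N * D ≤ q * L →
  (ℤ.+ a) ÷ q ℚ.≤ ((ℤ.+ S) ÷ (B * L)) {{m*n≢0 B L}} ℚ.+ (ℤ.+ 1) ÷ B ℚ.+ (ℤ.+ 1) ÷ D
fraction≤mean+1/B+1/D a q@(suc _) B@(suc _) L@(suc _) D@(suc _) S N counted few =
  subst ((ℤ.+ a) ÷ q ℚ.≤_) (sym sum-of-fractions) (fraction-≤ a q numerator (B * L * B * D) cross)
  where
  numerator : ℕ
  numerator = (S * B + 1 * (B * L)) * D + 1 * (B * L * B)
  sum-of-fractions : (ℤ.+ S) ÷ (B * L) ℚ.+ (ℤ.+ 1) ÷ B ℚ.+ (ℤ.+ 1) ÷ D ≡
                     (ℤ.+ numerator) ÷ (B * L * B * D)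
  sum-of-fractions = trans (cong (ℚ._+ (ℤ.+ 1) ÷ D) (fraction-+ S 1 (B * L) B))
                           (fraction-+ (S * B + 1 * (B * L)) 1 (B * L * B) D)
  open ≤-Reasoning
  cross : a * (B * L * B * D) ≤ numerator * q
  cross = begin
    a * (B * L * B * D)                      ≡⟨ e₁ a B L D ⟩
    B * (a * B * L * D)                      ≤⟨ *-monoʳ-≤ B (*-monoˡ-≤ D counted) ⟩
    B * ((q * (S + L) + a * B * N) * D)      ≡⟨ cong (B *_) (e₂ a q B S L N D) ⟩
    B * (q * (S + L) * D + B * (a * N * D))  ≤⟨ *-monoʳ-≤ B (+-monoʳ-≤ _ (*-monoʳ-≤ B few)) ⟩
    B * (q * (S + L) * D + B * (q * L))      ≡⟨ e₃ q B S L D ⟩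
    numerator * q                            ∎
    where
    e₁ : ∀ a B L D → a * (B * L * B * D) ≡ B * (a * B * L * D)
    e₁ = solve-∀
    e₂ : ∀ a q B S L N D → (q * (S + L) + a * B * N) * D ≡ q * (S + L) * D + B * (a * N * D)
    e₂ = solve-∀
    e₃ : ∀ q B S L D → B * (q * (S + L) * D + B * (q * L)) ≡
                       ((S * B + 1 * (B * L)) * D + 1 * (B * L * B)) * q
    e₃ = solve-∀

avgFullness-≡ : ∀ b s .{{_ : NonZero (length s)}} →
                avgFullness (suc b) s ≡
                ((ℤ.+ sum s) ÷ (suc b * length s)) {{m*n≢0 (suc b) (length s)}}
avgFullness-≡ b s with length s
... | suc _ = refl

module DeferredEvenSplitting (b r : ℕ) (0<r : 0 < r) (2B<3r : 2 * suc b < 3 * r) where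

  B : ℕ
  B = suc b

  c : ℕ
  c = ceilDiv r B

  a₂ q₂ : ℕ
  a₂ = 2 * r + B
  q₂ = 2 * B * suc c

  -- Measured with x + 1 keys: the extra key is where the -1/B of the bound comes from.
  FillsAtLeast : ℕ → ℕ → Pred ℕ _
  FillsAtLeast a q x = a * B ≤ q * suc x

  Good : Pred ℕ _
  Good x = FillsAtLeast 2 3 x × FillsAtLeast a₂ q₂ x

  good? : Decidable Good
  good? x = (2 * B ≤? 3 * suc x) ×-dec (a₂ * B ≤? q₂ * suc x)

  Viable : Pred ℕ _
  Viable x = x ≤ B × B ≤ 2 * suc x × 4 * B < 3 * suc (r + x)

  r≤cB : r ≤ c * B
  r≤cB = ceilDiv-lower r b

  0<c : 0 < c
  0<c with c | r≤cB
  ... | zero  | r≤0 = contradiction (≤-trans 0<r r≤0) λ ()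
  ... | suc _ | _   = z<s

  B<2r : B < 2 * r
  B<2r = *-cancelˡ-< 2 B (2 * r) (begin-strict
    2 * B        <⟨ 2B<3r ⟩
    3 * r        ≤⟨ *-monoˡ-≤ r (n≤1+n 3) ⟩
    4 * r        ≡⟨ *-assoc 2 2 r ⟩
    2 * (2 * r)  ∎)
    where open ≤-Reasoning

  fills-2/3-of-≥r : ∀ {x} → r ≤ x → FillsAtLeast 2 3 x
  fills-2/3-of-≥r r≤x = <⇒≤ (≤-trans 2B<3r (*-monoʳ-≤ 3 (m≤n⇒m≤1+n r≤x)))

  -- Two pieces: viability gives 3(m + 1) > 4B.  K ≥ 3 pieces: (K - 1)B < K(x + 1), (K - 1)/K ≥ 2/3.
  fills-2/3-of-split : ∀ {m x} k → suc k * B < m → 4 * B < 3 * suc m → m < (2 + k) * suc x →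
                       FillsAtLeast 2 3 x
  fills-2/3-of-split {m} {x} zero _ 4B<3[1+m] m<2[1+x] =
    <⇒≤ (*-cancelˡ-< 2 (2 * B) (3 * suc x) (begin-strict
      2 * (2 * B)      ≡⟨ *-assoc 2 2 B ⟨
      4 * B            <⟨ 4B<3[1+m] ⟩
      3 * suc m        ≤⟨ *-monoʳ-≤ 3 m<2[1+x] ⟩
      3 * (2 * suc x)  ≡⟨ e (suc x) ⟩
      2 * (3 * suc x)  ∎))
    where
    open ≤-Reasoning
    e : ∀ y → 3 * (2 * y) ≡ 2 * (3 * y)
    e = solve-∀
  fills-2/3-of-split {m} {x} (suc j) kB<m _ m<Kx =
    <⇒≤ (k*B<[1+k]*x⇒i*B<[1+j]*x 2 2 (2 + j) B (suc x) (<-trans kB<m m<Kx) ratio)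
    where
    ratio : 2 * (3 + j) ≤ 3 * (2 + j)
    ratio = ≤-trans (m≤m+n (2 * (3 + j)) j) (≤-reflexive (e j))
      where
      e : ∀ j → 2 * (3 + j) + j ≡ 3 * (2 + j)
      e = solve-∀

  fills-a₂/q₂ : ∀ {ℓ x} k → B ≤ 2 * suc ℓ → k ≤ suc c → r + ℓ < k * suc x → FillsAtLeast a₂ q₂ x
  fills-a₂/q₂ {ℓ} {x} k B≤2[1+ℓ] k≤1+c m<kx = begin
    a₂ * B                   ≤⟨ *-monoˡ-≤ B a₂≤ ⟩
    2 * (suc c * suc x) * B  ≡⟨ e c x B ⟩
    q₂ * suc x               ∎
    where
    open ≤-Reasoning
    a₂≤ : a₂ ≤ 2 * (suc c * suc x)
    a₂≤ = begin
      2 * r + B            ≤⟨ +-monoʳ-≤ (2 * r) B≤2[1+ℓ] ⟩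
      2 * r + 2 * suc ℓ    ≡⟨ *-distribˡ-+ 2 r (suc ℓ) ⟨
      2 * (r + suc ℓ)      ≡⟨ cong (2 *_) (+-suc r ℓ) ⟩
      2 * suc (r + ℓ)      ≤⟨ *-monoʳ-≤ 2 (≤-trans m<kx (*-monoˡ-≤ (suc x) k≤1+c)) ⟩
      2 * (suc c * suc x)  ∎
    e : ∀ c x B → 2 * (suc c * suc x) * B ≡ 2 * B * suc c * suc x
    e = solve-∀

  pieces≤1+c : ∀ {ℓ} k → ℓ ≤ B → suc k * B < r + ℓ → 2 + k ≤ suc c
  pieces≤1+c {ℓ} k ℓ≤B kB<m = *-cancelʳ-< B (suc k) (suc c) (begin-strict
    suc k * B  <⟨ kB<m ⟩
    r + ℓ      ≤⟨ +-mono-≤ r≤cB ℓ≤B ⟩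
    c * B + B  ≡⟨ +-comm (c * B) B ⟩
    suc c * B  ∎)
    where open ≤-Reasoning

  insertBatch-good : ∀ {ℓ} → Viable ℓ → All Good (insertBatch B r ℓ)
  insertBatch-good {ℓ} (ℓ≤B , B≤2[1+ℓ] , 4B<3[1+m]) = insertBatch-elim (All Good) b r ℓ
    (λ _ → (fills-2/3-of-≥r (m≤m+n r ℓ) , fills-a₂/q₂ 1 B≤2[1+ℓ] (s≤s z≤n) m<1*[1+m]) ∷ [])
    (λ k kB<m _ → All.map (λ m<Kx → fills-2/3-of-split k kB<m 4B<3[1+m] m<Kx ,
                                     fills-a₂/q₂ (2 + k) B≤2[1+ℓ] (pieces≤1+c k ℓ≤B kB<m) m<Kx)
                          (evenSplit-lower (r + ℓ) (suc k)))
    where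
    m<1*[1+m] : r + ℓ < 1 * suc (r + ℓ)
    m<1*[1+m] = ≤-reflexive (sym (*-identityˡ (suc (r + ℓ))))

  good⇒viable : ∀ {x} → x ≤ B → Good x → Viable x
  good⇒viable {x} x≤B (2B≤3[1+x] , _) = x≤B , B≤2[1+x] , 4B<3[1+r+x]
    where
    open ≤-Reasoning
    B≤2[1+x] : B ≤ 2 * suc x
    B≤2[1+x] = *-cancelˡ-≤ 2 (begin
      2 * B              ≤⟨ 2B≤3[1+x] ⟩
      3 * suc x          ≤⟨ *-monoˡ-≤ (suc x) (n≤1+n 3) ⟩
      4 * suc x          ≡⟨ *-assoc 2 2 (suc x) ⟩
      2 * (2 * suc x)    ∎)
    4B<3[1+r+x] : 4 * B < 3 * suc (r + x)
    4B<3[1+r+x] = begin-strict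
      4 * B                  ≡⟨ e B ⟩
      2 * B + 2 * B          <⟨ +-mono-<-≤ 2B<3r 2B≤3[1+x] ⟩
      3 * r + 3 * suc x      ≡⟨ *-distribˡ-+ 3 r (suc x) ⟨
      3 * (r + suc x)        ≡⟨ cong (3 *_) (+-suc r x) ⟩
      3 * suc (r + x)        ∎
      where
      e : ∀ B → 4 * B ≡ 2 * B + 2 * B
      e = solve-∀

  insertBatch-viable : ∀ {ℓ} → Viable ℓ → All Viable (insertBatch B r ℓ)
  insertBatch-viable {ℓ} v =
    All.zipWith (λ (x≤B , good) → good⇒viable x≤B good) (insertBatch-≤ b r ℓ , insertBatch-good v)

  viable-of-≥r : ∀ {x} → x ≤ B → r ≤ x → Viable x
  viable-of-≥r {x} x≤B r≤x = x≤B , <⇒≤ (≤-trans B<2r (*-monoʳ-≤ 2 (m≤n⇒m≤1+n r≤x))) , 4B<3[1+r+x]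
    where
    open ≤-Reasoning
    4B<3[1+r+x] : 4 * B < 3 * suc (r + x)
    4B<3[1+r+x] = begin-strict
      4 * B              ≡⟨ *-assoc 2 2 B ⟩
      2 * (2 * B)        <⟨ *-monoʳ-< 2 2B<3r ⟩
      2 * (3 * r)        ≡⟨ e r ⟩
      3 * (r + r)        ≤⟨ *-monoʳ-≤ 3 (m≤n⇒m≤1+n (+-monoʳ-≤ r r≤x)) ⟩
      3 * suc (r + x)    ∎
      where
      e : ∀ r → 2 * (3 * r) ≡ 3 * (r + r)
      e = solve-∀

  viable-of-initial-piece : ∀ {x} k → suc k * B < r + 0 → x ≤ B → r + 0 < (2 + k) * suc x → Viable x
  viable-of-initial-piece {x} k kB<r x≤B r<Kx = x≤B , B≤2[1+x] , 4B<3[1+r+x]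
    where
    open ≤-Reasoning
    B≤2[1+x] : B ≤ 2 * suc x
    B≤2[1+x] = ≤-trans (≤-reflexive (sym (*-identityˡ B)))
      (<⇒≤ (k*B<[1+k]*x⇒i*B<[1+j]*x 1 1 (suc k) B (suc x) (<-trans kB<r r<Kx) ratio))
      where
      ratio : 1 * (2 + k) ≤ 2 * (1 + k)
      ratio = ≤-trans (m≤m+n (1 * (2 + k)) k) (≤-reflexive (e k))
        where
        e : ∀ k → 1 * (2 + k) + k ≡ 2 * (1 + k)
        e = solve-∀
    B<r : B < r
    B<r = begin-strict
      B          ≤⟨ m≤m+n B (k * B) ⟩
      suc k * B  <⟨ kB<r ⟩
      r + 0      ≡⟨ +-identityʳ r ⟩
      r          ∎
    4B<3[1+r+x] : 4 * B < 3 * suc (r + x)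
    4B<3[1+r+x] = *-cancelˡ-< 2 (4 * B) (3 * suc (r + x)) (begin-strict
      2 * (4 * B)               ≡⟨ e₁ B ⟩
      6 * B + 2 * B             <⟨ +-mono-<-≤ (*-monoʳ-< 6 B<r) (*-monoʳ-≤ 2 B≤2[1+x]) ⟩
      6 * r + 2 * (2 * suc x)   ≤⟨ +-monoʳ-≤ (6 * r) (*-monoˡ-≤ (2 * suc x) (n≤1+n 2)) ⟩
      6 * r + 3 * (2 * suc x)   ≡⟨ e₂ r x ⟩
      2 * (3 * suc (r + x))     ∎)
      where
      e₁ : ∀ B → 2 * (4 * B) ≡ 6 * B + 2 * B
      e₁ = solve-∀
      e₂ : ∀ r x → 6 * r + 3 * (2 * suc x) ≡ 2 * (3 * suc (r + x))
      e₂ = solve-∀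

  insertBatch-initial-viable : All Viable (insertBatch B r 0)
  insertBatch-initial-viable = insertBatch-elim (All Viable) b r 0
    (λ m≤B → viable-of-≥r m≤B (m≤m+n r 0) ∷ [])
    (λ k kB<r r≤KB → All.zipWith (λ (x≤B , r<Kx) → viable-of-initial-piece k kB<r x≤B r<Kx)
                                 (evenSplit-upper (r + 0) (suc k) r≤KB ,
                                  evenSplit-lower (r + 0) (suc k)))

  length-insertBatch-initial : length (insertBatch B r 0) ≤ c
  length-insertBatch-initial = insertBatch-elim (λ xs → length xs ≤ c) b r 0
    (λ _ → 0<c)
    (λ k kB<r _ → subst (_≤ c) (sym (length-evenSplit (r + 0) (suc k))) (pieces≤c k kB<r))
    where
    pieces≤c : ∀ k → suc k * B < r + 0 → 2 + k ≤ c
    pieces≤c k kB<r = *-cancelʳ-< B (suc k) c (begin-strict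
      suc k * B  <⟨ kB<r ⟩
      r + 0      ≡⟨ +-identityʳ r ⟩
      r          ≤⟨ r≤cB ⟩
      c * B      ∎)
      where open ≤-Reasoning

  Invariant : List ℕ → Set
  Invariant s = All Viable s × failures good? s ≤ c

  module _ (choice : ℕ → ℕ) where

    private
      insert : ℕ → List ℕ
      insert = insertBatch B r
      blocks : ℕ → List ℕ
      blocks = run B r choice

    run-nonEmpty : ∀ n → 0 < length (blocks n)
    run-nonEmpty zero    = z<s
    run-nonEmpty (suc n) =
      applyAt-nonEmpty insert (insertBatch-nonEmpty b r) (choice n) (blocks n) (run-nonEmpty n)

    sum-run : ∀ n → sum (blocks n) ≡ n * r
    sum-run zero    = refl
    sum-run (suc n) =
      trans (applyAt-sum insert (sum-insertBatch b r) (choice n) (blocks n) (run-nonEmpty n))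
            (cong (r +_) (sum-run n))

    run-invariant : ∀ n → Invariant (blocks (suc n))
    run-invariant zero = subst Invariant (sym (applyAt-singleton insert (choice 0) 0))
      (insertBatch-initial-viable , ≤-trans (failures≤length good? (insert 0)) length-insertBatch-initial)
    run-invariant (suc n) with run-invariant n
    ... | viable , few =
      applyAt-All insert insertBatch-viable (choice (suc n)) (blocks (suc n)) viable ,
      ≤-trans (applyAt-failures insert good? insertBatch-good (choice (suc n)) (blocks (suc n)) viable) few

    length-run : ∀ {W} n → W * B ≤ suc n → W ≤ length (blocks (suc n))
    length-run {W} n WB≤n = *-cancelʳ-≤ W _ B (begin
      W * B                        ≤⟨ WB≤n ⟩
      suc n                        ≤⟨ m≤m*n (suc n) r ⟩
      suc n * r                    ≡⟨ sum-run (suc n) ⟨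
      sum (blocks (suc n))         ≤⟨ sum≤length*m (All.map proj₁ (proj₁ (run-invariant n))) ⟩
      length (blocks (suc n)) * B  ∎)
      where
      open ≤-Reasoning
      instance
        r≢0 : NonZero r
        r≢0 = >-nonZero 0<r

  bound-≤-avgFullness : ∀ {ε} d → (ℤ.+ 1) ÷ suc d ℚ.≤ ε →
    ∀ s .{{_ : NonZero (length s)}} → Invariant s → a₂ * c * suc d ≤ length s →
    bound B r ℚ.- ε ℚ.≤ avgFullness B s
  bound-≤-avgFullness {ε} d 1/D≤ε s (_ , few) long =
    p≤q+r+s⇒p-r-s≤q (ℚ.⊔-lub (below 2 3 proj₁ (≤-trans (n≤1+n 2) (*-monoˡ-≤ 3 0<a₂)))
                            (below a₂ q₂ proj₂ (m≤m*n a₂ q₂)))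
    where
    0<a₂ : 0 < a₂
    0<a₂ = ≤-trans z<s (m≤n+m B (2 * r))
    below : ∀ a q .{{_ : NonZero q}} → (∀ {x} → Good x → FillsAtLeast a q x) → a ≤ a₂ * q →
            (ℤ.+ a) ÷ q ℚ.≤ avgFullness B s ℚ.+ (ℤ.+ 1) ÷ B ℚ.+ ε
    below a q fills a≤a₂q = chain
      where
      slack : a * failures good? s * suc d ≤ q * length s
      slack = begin
        a * failures good? s * suc d   ≤⟨ *-monoˡ-≤ (suc d) (*-mono-≤ a≤a₂q few) ⟩
        a₂ * q * c * suc d             ≡⟨ e a₂ q c (suc d) ⟩
        q * (a₂ * c * suc d)           ≤⟨ *-monoʳ-≤ q long ⟩
        q * length s                   ∎
        where
        open ≤-Reasoning
        e : ∀ a₂ q c D → a₂ * q * c * D ≡ q * (a₂ * c * D)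
        e = solve-∀
      chain : (ℤ.+ a) ÷ q ℚ.≤ avgFullness B s ℚ.+ (ℤ.+ 1) ÷ B ℚ.+ ε
      chain = begin
        (ℤ.+ a) ÷ q
          ≤⟨ fraction≤mean+1/B+1/D a q B (length s) (suc d) (sum s) (failures good? s)
               (length≤sum+failures good? (a * B) q fills s) slack ⟩
        ((ℤ.+ sum s) ÷ (B * length s)) {{m*n≢0 B (length s)}} ℚ.+ (ℤ.+ 1) ÷ B ℚ.+ (ℤ.+ 1) ÷ suc d
          ≡⟨ cong (λ avg → avg ℚ.+ (ℤ.+ 1) ÷ B ℚ.+ (ℤ.+ 1) ÷ suc d) (avgFullness-≡ b s) ⟨
        avgFullness B s ℚ.+ (ℤ.+ 1) ÷ B ℚ.+ (ℤ.+ 1) ÷ suc d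
          ≤⟨ ℚ.+-monoʳ-≤ (avgFullness B s ℚ.+ (ℤ.+ 1) ÷ B) 1/D≤ε ⟩
        avgFullness B s ℚ.+ (ℤ.+ 1) ÷ B ℚ.+ ε
          ∎
        where open ℚ.≤-Reasoning

lemma15 : (B r : ℕ) → 0 < B → 0 < r → 2 * B < 3 * r →
    (choice : ℕ → ℕ) → (ε : ℚ) → 0ℚ ℚ.< ε →
    ∃[ N ] ((n : ℕ) → n ≥ N →
    bound B r ℚ.- ε ℚ.≤ avgFullness B (run B r choice n))
lemma15 zero    _ () _ _ _ _ _
lemma15 (suc b) r _ 0<r 2B<3r choice ε 0<ε with 0<ε⇒∃1/[1+d]≤ε ε 0<ε
... | d , 1/D≤ε = suc (W * B) , eventually
  where
  open DeferredEvenSplitting b r 0<r 2B<3r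
  W : ℕ
  W = a₂ * c * suc d
  eventually : ∀ n → n ≥ suc (W * B) → bound B r ℚ.- ε ℚ.≤ avgFullness B (run B r choice n)
  eventually (suc n) (s≤s WB≤n) =
    bound-≤-avgFullness d 1/D≤ε (run B r choice (suc n)) {{>-nonZero (run-nonEmpty choice (suc n))}}
      (run-invariant choice n) (length-run choice n (m≤n⇒m≤1+n WB≤n))
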